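{- Let $A=(A[i])_{i=0}^n$ and $B=(B[j])_{j=0}^n$ be vectors of non-negative integers, $\ell\ge 0$ an integer, $A^\ell[i]=\lfloor A[i]/2^\ell\rfloor$, $B^\ell[j]=\lfloor B[j]/2^\ell\rfloor$, and $C^\ell[k]=\max_{i+j=k}\min\{A^\ell[i],\,B^\ell[j]+\lfloor k/2^\ell\rfloor\}$ for $k\in\{0,\ldots,2n\}$ (maximum over $i,j\in\{0,\ldots,n\}$ with $i+j=k$). Let $D^\ell$ be a vector with $C^\ell[k]-2\le D^\ell[k]\le C^\ell[k]$ for all $k$. Define, for $k\in\{0,\ldots,2n\}$, $L^\ell[k]=\max\{A^\ell[i_0] : A^\ell[i_0]\le B^\ell[k-i_0]+\lfloor k/2^\ell\rfloor \text{ and } D^\ell[k]\le A^\ell[i_0]\le D^\ell[k]+2\}$ and $R^\ell[k]=\max\{B^\ell[j_0]+\lfloor k/2^\ell\rfloor : B^\ell[j_0]+\lfloor k/2^\ell\rfloor\le A^\ell[k-j_0] \text{ and } D^\ell[k]\le B^\ell[j_0]+\lfloor k/2^\ell\rfloor\le D^\ell[k]+2\}$, where $i_0$ (resp. $j_0$) ranges over indices with $i_0,k-i_0\in\{0,\ldots,n\}$ (resp. $j_0,k-j_0\in\{0,\ldots,n\}$), and the maximum of an empty set is $-\infty$. Then $C^\ell[k]=\max\{L^\ell[k],R^\ell[k]\}$ for each $k\in\{0,\ldots,2n\}$. -}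

module Defs where

open import Data.Nat using (ℕ; _+_; _^_; _⊔_; _/_; _≤?_)
open import Data.Nat.Properties using (m^n≢0)
open import Data.Nat as ℕ using ()
open import Data.Integer as ℤ using (ℤ; +_)
open import Data.Fin using (Fin; toℕ)
open import Data.List using (List; []; _∷_; foldr; concatMap; allFin)
open import Data.Maybe using (Maybe; just; nothing; maybe′)
open import Data.Bool using (Bool; if_then_else_; _∧_)
open import Relation.Nullary.Decidable using (⌊_⌋)

shr : ℕ → ℕ → ℕ
shr ℓ m = _/_ m (2 ^ ℓ) {{m^n≢0 2 ℓ}}

-- maximum of a finite list of naturals; nothing = −∞ (empty maximum)
maxList : List ℕ → Maybe ℕ
maxList = foldr (λ x m → just (maybe′ (x ⊔_) x m)) nothing

maxM : Maybe ℕ → Maybe ℕ → Maybe ℕ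
maxM nothing  m = m
maxM (just x) m = just (maybe′ (x ⊔_) x m)

pairVals : ∀ {n} → ℕ → (Fin n → Fin n → Bool) → (Fin n → Fin n → ℕ) → List ℕ
pairVals {n} k cond v =
  concatMap (λ i → concatMap (λ j →
    if ⌊ toℕ i + toℕ j ℕ.≟ k ⌋ ∧ cond i j then v i j ∷ [] else [])
    (allFin n)) (allFin n)

module _ {n : ℕ} (A B : Fin (ℕ.suc n) → ℕ) (ℓ : ℕ) where

  Aℓ : Fin (ℕ.suc n) → ℕ
  Aℓ i = shr ℓ (A i)

  Bℓ : Fin (ℕ.suc n) → ℕ
  Bℓ j = shr ℓ (B j)

  -- C^ℓ[k] = max_{i+j=k} min{A^ℓ[i], B^ℓ[j] + ⌊k/2^ℓ⌋}  (as ℕ ∪ {−∞};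
  -- it is never −∞ for k ≤ 2n)
  Cℓ : ℕ → Maybe ℕ
  Cℓ k = maxList (pairVals k (λ _ _ → Bool.true)
                   (λ i j → Aℓ i ℕ.⊓ (Bℓ j + shr ℓ k)))
    where import Data.Bool as Bool

  module _ (D : ℕ → ℤ) where


    Lℓ : ℕ → Maybe ℕ
    Lℓ k = maxList (pairVals k
      (λ i j → ⌊ Aℓ i ≤? Bℓ j + shr ℓ k ⌋
             ∧ ⌊ D k ℤ.≤? + Aℓ i ⌋ ∧ ⌊ + Aℓ i ℤ.≤? D k ℤ.+ + 2 ⌋)
      (λ i j → Aℓ i))

    Rℓ : ℕ → Maybe ℕ
    Rℓ k = maxList (pairVals k
      (λ i j → ⌊ Bℓ j + shr ℓ k ≤? Aℓ i ⌋
             ∧ ⌊ D k ℤ.≤? + (Bℓ j + shr ℓ k) ⌋ ∧ ⌊ + (Bℓ j + shr ℓ k) ℤ.≤? D k ℤ.+ + 2 ⌋)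
      (λ i j → Bℓ j + shr ℓ k))

-- C^ℓ[k] is the largest of the values min{A^ℓ[i], B^ℓ[j] + ⌊k/2^ℓ⌋} with i + j = k.
-- Every such minimum equals one of its two arguments, so it is a candidate for
-- L^ℓ[k] or R^ℓ[k] as soon as it lies in the window [D^ℓ[k], D^ℓ[k] + 2]; the
-- hypothesis on D^ℓ puts C^ℓ[k] itself in that window. Conversely every candidate
-- is one of the minima, hence at most C^ℓ[k].
module Submission where

open import Defs
open import Data.Nat using (ℕ; suc; _≤_; _+_; _⊓_; _≤?_; _≟_)
open import Data.Nat.Properties
  using (≤-refl; ≤-trans; ≤-antisym; ≤-total; m≤m⊔n; m≤n⊔m; ⊔-sel; ⊔-assoc;
         m≤n⇒m⊓n≡m; m≥n⇒m⊓n≡n)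
open import Data.Integer as ℤ using (ℤ; +_)
import Data.Integer.Properties as ℤ
open import Data.Fin using (Fin; toℕ)
open import Data.Product using (_×_; _,_; ∃; ∃₂; proj₂)
open import Data.Sum using (inj₁; inj₂; [_,_]′)
open import Data.Empty using (⊥-elim)
open import Data.List using (List; []; _∷_; _++_; concatMap; allFin)
open import Data.List.Membership.Propositional using (_∈_; lose)
open import Data.List.Membership.Propositional.Properties
  using (∈-concatMap⁺; ∈-concatMap⁻; ∈-allFin; ∈-++⁺ˡ; ∈-++⁺ʳ; ∈-++⁻)
open import Data.List.Relation.Unary.Any using (here; there; satisfied)
open import Data.List.Relation.Binary.Subset.Propositional using (_⊆_)
open import Data.Maybe using (just; nothing)
open import Data.Bool using (Bool; true; T; _∧_; if_then_else_)
open import Data.Bool.Properties using (T-∧)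
open import Function.Base using (_∘_)
open import Function.Bundles using (module Equivalence)
open import Relation.Nullary using (yes; no; contradiction)
open import Relation.Nullary.Decidable using (⌊_⌋; toWitness; fromWitness)
open import Relation.Binary.PropositionalEquality
  using (_≡_; refl; sym; trans; cong; subst; module ≡-Reasoning)

maxM-maxList-++ : ∀ xs ys → maxM (maxList xs) (maxList ys) ≡ maxList (xs ++ ys)
maxM-maxList-++ []       ys = refl
maxM-maxList-++ (x ∷ xs) ys rewrite sym (maxM-maxList-++ xs ys) with maxList xs | maxList ys
... | nothing | _       = refl
... | just a  | nothing = refl
... | just a  | just b  = cong just (⊔-assoc x a b)

∈⇒maxList≡just : ∀ {x xs} → x ∈ xs → ∃ λ m → maxList xs ≡ just m
∈⇒maxList≡just {xs = _ ∷ _} _ = _ , refl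

maxList-∈ : ∀ xs {m} → maxList xs ≡ just m → m ∈ xs
maxList-∈ (x ∷ xs) refl with maxList xs in eq
... | nothing = here refl
... | just a with ⊔-sel x a
...   | inj₁ x⊔a≡x = here x⊔a≡x
...   | inj₂ x⊔a≡a = there (subst (_∈ xs) (sym x⊔a≡a) (maxList-∈ xs eq))

∈⇒≤-maxList : ∀ {x} xs {m} → x ∈ xs → maxList xs ≡ just m → x ≤ m
∈⇒≤-maxList (x ∷ [])     (here refl) refl = ≤-refl
∈⇒≤-maxList (x ∷ y ∷ xs) (here refl) refl = m≤m⊔n x _
∈⇒≤-maxList (x ∷ y ∷ xs) (there p)   refl = ≤-trans (∈⇒≤-maxList (y ∷ xs) p refl) (m≤n⊔m x _)

maxList-⊆ : ∀ {xs ys} → ys ⊆ xs → (∀ {m} → maxList xs ≡ just m → m ∈ ys) →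
            maxList xs ≡ maxList ys
maxList-⊆ {xs} {[]} _ max∈ys with maxList xs
... | nothing = refl
... | just m with max∈ys refl
...   | ()
maxList-⊆ {xs} {ys@(_ ∷ _)} ys⊆xs max∈ys =
  equal-maxima (proj₂ (∈⇒maxList≡just (ys⊆xs (here refl)))) refl
  where
  equal-maxima : ∀ {m m′} → maxList xs ≡ just m → maxList ys ≡ just m′ →
                 maxList xs ≡ maxList ys
  equal-maxima xs≡m ys≡m′ = trans xs≡m (trans (cong just m≡m′) (sym ys≡m′))
    where
    m≡m′ = ≤-antisym (∈⇒≤-maxList ys (max∈ys xs≡m) ys≡m′)
                     (∈⇒≤-maxList xs (ys⊆xs (maxList-∈ ys ys≡m′)) xs≡m)

∈-if⁻ : ∀ {A : Set} {b} {x y : A} → x ∈ (if b then y ∷ [] else []) → T b × x ≡ y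
∈-if⁻ {b = true} (here x≡y) = _ , x≡y

∈-if⁺ : ∀ {A : Set} {b} {y : A} → T b → y ∈ (if b then y ∷ [] else [])
∈-if⁺ {b = true} _ = here refl

module _ {n k : ℕ} {cond : Fin n → Fin n → Bool} {v : Fin n → Fin n → ℕ} where

  private
    cell : Fin n → Fin n → List ℕ
    cell i j = if ⌊ toℕ i + toℕ j ≟ k ⌋ ∧ cond i j then v i j ∷ [] else []

    row : Fin n → List ℕ
    row i = concatMap (cell i) (allFin n)

  ∈-pairVals⁻ : ∀ {x} → x ∈ pairVals k cond v →
                ∃₂ λ i j → toℕ i + toℕ j ≡ k × T (cond i j) × x ≡ v i j
  ∈-pairVals⁻ x∈ =
    let i , x∈row      = satisfied (∈-concatMap⁻ row {xs = allFin n} x∈)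
        j , x∈cell     = satisfied (∈-concatMap⁻ (cell i) {xs = allFin n} x∈row)
        guard , x≡vᵢⱼ  = ∈-if⁻ x∈cell
        i+j≟k , condᵢⱼ = Equivalence.to T-∧ guard
    in i , j , toWitness i+j≟k , condᵢⱼ , x≡vᵢⱼ

  ∈-pairVals⁺ : ∀ i j → toℕ i + toℕ j ≡ k → T (cond i j) → v i j ∈ pairVals k cond v
  ∈-pairVals⁺ i j i+j≡k condᵢⱼ =
    ∈-concatMap⁺ row (lose (∈-allFin i) (∈-concatMap⁺ (cell i) (lose (∈-allFin j)
      (∈-if⁺ (Equivalence.from T-∧ (fromWitness i+j≡k , condᵢⱼ))))))

pairVals-⊆ : ∀ {n k} {cond cond′ : Fin n → Fin n → Bool} {v v′ : Fin n → Fin n → ℕ} →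
             (∀ {i j} → T (cond i j) → T (cond′ i j) × v i j ≡ v′ i j) →
             pairVals k cond v ⊆ pairVals k cond′ v′
pairVals-⊆ {cond = cond} {cond′} {v} {v′} sel x∈ =
  let i , j , i+j≡k , condᵢⱼ , x≡vᵢⱼ = ∈-pairVals⁻ {cond = cond} {v = v} x∈
      cond′ᵢⱼ , vᵢⱼ≡v′ᵢⱼ            = sel condᵢⱼ
  in subst (_∈ _) (sym (trans x≡vᵢⱼ vᵢⱼ≡v′ᵢⱼ))
           (∈-pairVals⁺ {cond = cond′} {v = v′} i j i+j≡k cond′ᵢⱼ)

i-j≤k⇒i≤k+j : ∀ {i j k : ℤ} → i ℤ.- j ℤ.≤ k → i ℤ.≤ k ℤ.+ j
i-j≤k⇒i≤k+j {i} {j} {k} i-j≤k = subst (ℤ._≤ k ℤ.+ j) i-j+j≡i (ℤ.+-monoˡ-≤ j i-j≤k)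
  where
  open ≡-Reasoning
  i-j+j≡i : i ℤ.- j ℤ.+ j ≡ i
  i-j+j≡i = begin
    i ℤ.- j ℤ.+ j       ≡⟨ ℤ.+-assoc i (ℤ.- j) j ⟩
    i ℤ.+ (ℤ.- j ℤ.+ j) ≡⟨ cong (ℤ._+_ i) (ℤ.+-inverseˡ j) ⟩
    i ℤ.+ ℤ.0ℤ          ≡⟨ ℤ.+-identityʳ i ⟩
    i                   ∎

module Candidates {n : ℕ} (A B : Fin (suc n) → ℕ) (ℓ : ℕ) (D : ℕ → ℤ) (k : ℕ) where

  private
    a b : Fin (suc n) → ℕ
    a = Aℓ A B ℓ
    b j = Bℓ A B ℓ j + shr ℓ k

  inWindow : ℕ → Bool
  inWindow w = ⌊ D k ℤ.≤? + w ⌋ ∧ ⌊ + w ℤ.≤? D k ℤ.+ + 2 ⌋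

  leftCond rightCond : Fin (suc n) → Fin (suc n) → Bool
  leftCond  i j = ⌊ a i ≤? b j ⌋ ∧ inWindow (a i)
  rightCond i j = ⌊ b j ≤? a i ⌋ ∧ inWindow (b j)

  minVals leftVals rightVals : List ℕ
  minVals   = pairVals k (λ _ _ → true) (λ i j → a i ⊓ b j)
  leftVals  = pairVals k leftCond (λ i _ → a i)
  rightVals = pairVals k rightCond (λ _ j → b j)

  inWindow⁺ : ∀ {c} → + c ℤ.- + 2 ℤ.≤ D k → D k ℤ.≤ + c → T (inWindow c)
  inWindow⁺ {c} lo hi =
    Equivalence.from (T-∧ {⌊ D k ℤ.≤? + c ⌋})
      (fromWitness hi , fromWitness (i-j≤k⇒i≤k+j {+ c} {+ 2} lo))

  leftCond⇒≤ : ∀ {i j} → T (leftCond i j) → a i ≤ b j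
  leftCond⇒≤ {i} {j} t with a i ≤? b j
  ... | yes aᵢ≤bⱼ = aᵢ≤bⱼ
  ... | no _      = ⊥-elim t

  rightCond⇒≤ : ∀ {i j} → T (rightCond i j) → b j ≤ a i
  rightCond⇒≤ {i} {j} t with b j ≤? a i
  ... | yes bⱼ≤aᵢ = bⱼ≤aᵢ
  ... | no _      = ⊥-elim t

  leftCond⁺ : ∀ {i j} → a i ≤ b j → T (inWindow (a i)) → T (leftCond i j)
  leftCond⁺ {i} {j} aᵢ≤bⱼ w with a i ≤? b j
  ... | yes _    = w
  ... | no aᵢ≰bⱼ = contradiction aᵢ≤bⱼ aᵢ≰bⱼ

  rightCond⁺ : ∀ {i j} → b j ≤ a i → T (inWindow (b j)) → T (rightCond i j)
  rightCond⁺ {i} {j} bⱼ≤aᵢ w with b j ≤? a i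
  ... | yes _    = w
  ... | no bⱼ≰aᵢ = contradiction bⱼ≤aᵢ bⱼ≰aᵢ

  leftVals⊆minVals : leftVals ⊆ minVals
  leftVals⊆minVals =
    pairVals-⊆ {cond = leftCond} {v = λ i _ → a i} {v′ = λ i j → a i ⊓ b j}
      λ t → _ , sym (m≤n⇒m⊓n≡m (leftCond⇒≤ t))

  rightVals⊆minVals : rightVals ⊆ minVals
  rightVals⊆minVals =
    pairVals-⊆ {cond = rightCond} {v = λ _ j → b j} {v′ = λ i j → a i ⊓ b j}
      λ t → _ , sym (m≥n⇒m⊓n≡n (rightCond⇒≤ t))

  candidates⊆minVals : leftVals ++ rightVals ⊆ minVals
  candidates⊆minVals x∈ = [ leftVals⊆minVals , rightVals⊆minVals ]′ (∈-++⁻ leftVals x∈)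

  minVal∈candidates : ∀ i j → toℕ i + toℕ j ≡ k → T (inWindow (a i ⊓ b j)) →
                      a i ⊓ b j ∈ leftVals ++ rightVals
  minVal∈candidates i j i+j≡k w with ≤-total (a i) (b j)
  ... | inj₁ aᵢ≤bⱼ rewrite m≤n⇒m⊓n≡m aᵢ≤bⱼ =
    ∈-++⁺ˡ (∈-pairVals⁺ {cond = leftCond} {v = λ i _ → a i} i j i+j≡k (leftCond⁺ aᵢ≤bⱼ w))
  ... | inj₂ bⱼ≤aᵢ rewrite m≥n⇒m⊓n≡n bⱼ≤aᵢ =
    ∈-++⁺ʳ leftVals
      (∈-pairVals⁺ {cond = rightCond} {v = λ _ j → b j} i j i+j≡k (rightCond⁺ bⱼ≤aᵢ w))

  windowed-minVal∈candidates : ∀ {c} → c ∈ minVals → + c ℤ.- + 2 ℤ.≤ D k → D k ℤ.≤ + c →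
                               c ∈ leftVals ++ rightVals
  windowed-minVal∈candidates c∈ lo hi =
    let i , j , i+j≡k , _ , c≡aᵢ⊓bⱼ =
          ∈-pairVals⁻ {cond = λ _ _ → true} {v = λ i j → a i ⊓ b j} c∈
    in subst (_∈ leftVals ++ rightVals) (sym c≡aᵢ⊓bⱼ)
             (minVal∈candidates i j i+j≡k (subst (T ∘ inWindow) c≡aᵢ⊓bⱼ (inWindow⁺ lo hi)))

lemma8 : (n : ℕ) (A B : Fin (suc n) → ℕ) (ℓ : ℕ) (D : ℕ → ℤ)
         → (∀ k c → k ≤ n + n → Cℓ A B ℓ k ≡ just c → + c ℤ.- + 2 ℤ.≤ D k × D k ℤ.≤ + c)
         → ∀ k → k ≤ n + n → Cℓ A B ℓ k ≡ maxM (Lℓ A B ℓ D k) (Rℓ A B ℓ D k)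
lemma8 n A B ℓ D C-window k k≤n+n = begin
  maxList minVals                             ≡⟨ maxList-⊆ candidates⊆minVals max∈candidates ⟩
  maxList (leftVals ++ rightVals)             ≡⟨ maxM-maxList-++ leftVals rightVals ⟨
  maxM (maxList leftVals) (maxList rightVals) ∎
  where
  open Candidates A B ℓ D k
  open ≡-Reasoning
  max∈candidates : ∀ {c} → maxList minVals ≡ just c → c ∈ leftVals ++ rightVals
  max∈candidates Cₖ≡c =
    let lo , hi = C-window k _ k≤n+n Cₖ≡c
    in windowed-minVal∈candidates (maxList-∈ minVals Cₖ≡c) lo hi
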